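{- Let $S\in\Sigma^n$, let $\ell^*$ be a natural number and let $m_1<\dots<m_h$ ($h\ge3$) be the midpoints of a maximal $\ell^*$-run in $S$. Then for every $j\in\{1,\dots,h\}\setminus\{\lfloor (h+1)/2\rfloor,\lceil (h+1)/2\rceil\}$, $$\ell(m_j)<\max\{\ell(m_{\lfloor (h+1)/2\rfloor}),\ \ell(m_{\lceil (h+1)/2\rceil})\}.$$
   Context: Palindromes are considered in their even form: $S$ contains a palindrome of length $\ell$ with midpoint $m$ if $S[m-i+1]=S[m+i]$ for all $i\in\{1,\dots,\ell\}$ (indices within $\{1,\dots,n\}$); $\ell(m)$ is the maximal such $\ell$, and $\ell(z)=0$ for $z\notin\{1,\dots,n\}$. The palindrome at $m$ is an $\ell^*$-palindrome if $\ell(m)\ge\ell^*$. An $\ell^*$-run is a sequence $m_1<\dots<m_h$, $h\ge3$, of consecutive midpoints of $\ell^*$-palindromes (no other $\ell^*$-palindrome midpoint lies between them) with $m_{j+1}-m_j\le\ell^*/2$ for all $j$. It is maximal if $\ell(m_1-(m_2-m_1))<\ell^*$ and $\ell(m_h+(m_2-m_1))<\ell^*$. -}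

module Defs where

open import Data.Nat using (ℕ; zero; suc; _+_; _*_; _∸_; _≤_; _<_)
open import Data.Vec using (Vec; []; _∷_)
open import Data.Maybe using (Maybe; just; nothing)
open import Data.Product using (_×_)
open import Relation.Binary.PropositionalEquality using (_≡_)

at : ∀ {A : Set} {n : ℕ} → Vec A n → ℕ → Maybe A
at []       _       = nothing
at (x ∷ xs) zero    = just x
at (x ∷ xs) (suc k) = at xs k

-- Pal S m l : S contains an (even) palindrome of length l with midpoint m,
-- i.e. S[m-i+1] = S[m+i] (1-based) for all i ∈ {1..l}, with all these
-- indices inside {1..n}  (i.e. l ≤ m - 1 + 1 = m  and  m + l ≤ n).
-- In 0-based terms S[m-i+1] is  at S (m ∸ i)  and S[m+i] is  at S (m + i ∸ 1).
Pal : ∀ {A : Set} {n : ℕ} → Vec A n → ℕ → ℕ → Set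
Pal {n = n} S m l =
  l ≤ m × m + l ≤ n ×
  (∀ i → 1 ≤ i → i ≤ l → at S (m ∸ i) ≡ at S (m + i ∸ 1))

IsMaxPalLen : ∀ {A : Set} {n : ℕ} → Vec A n → ℕ → ℕ → Set
IsMaxPalLen {n = n} S m L =
  (1 ≤ m → m ≤ n → Pal S m L × (∀ l → Pal S m l → l ≤ L)) ×
  ((m ≡ 0 → L ≡ 0) × (n < m → L ≡ 0))

IsPalLenFun : ∀ {A : Set} {n : ℕ} → Vec A n → (ℕ → ℕ) → Set
IsPalLenFun S ℓ = ∀ z → IsMaxPalLen S z (ℓ z)

IsMaximalRun : ∀ {A : Set} {n : ℕ} → Vec A n → (ℕ → ℕ) → ℕ → ℕ → (ℕ → ℕ) → Set
IsMaximalRun {n = n} S ℓ ℓ* h m =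
  3 ≤ h ×
  (∀ j → 1 ≤ j → j ≤ h → 1 ≤ m j × m j ≤ n × ℓ* ≤ ℓ (m j)) ×
  (∀ j → 1 ≤ j → j < h → m j < m (suc j)) ×
  (∀ j → 1 ≤ j → j < h → ∀ z → m j < z → z < m (suc j) → ℓ z < ℓ*) ×
  (∀ j → 1 ≤ j → j < h → 2 * (m (suc j) ∸ m j) ≤ ℓ*) ×
  -- maximality (m 1 ∸ d truncates to 0 exactly when m 1 - d ≤ 0, where ℓ = 0)
  ℓ (m 1 ∸ (m 2 ∸ m 1)) < ℓ* ×
  ℓ (m h + (m 2 ∸ m 1)) < ℓ*

-- Consecutive midpoints of a maximal ℓ*-run are equally spaced. Two ℓ*-palindromes whose
-- centres are g ≤ ℓ*/2 apart make the text 2g-periodic on the union of their windows, so if two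
-- consecutive gaps differed, the period of the narrower gap would extend across the wider one and
-- move the middle palindrome onto an ℓ*-palindrome midpoint strictly inside a gap.
-- With common gap Δ, reflecting palindromes about a midpoint c and the maximality of ℓ(c) give
-- ℓ(c) = Δ + min (ℓ(c − Δ), ℓ(c + Δ)) when the two neighbours differ, and ℓ(c) ≥ Δ + min (…)
-- otherwise. So along the run, extended by the points one gap beyond its ends (where ℓ < ℓ*),
-- ℓ rises in steps of Δ and then falls in steps of Δ; since both ends lie in [ℓ* − Δ, ℓ*), the
-- rise and the fall have equal length, which puts the maximum in the middle.
module Submission where

open import Defs
open import Data.Nat
  using (ℕ; zero; suc; _+_; _*_; _∸_; _≤_; _<_; _⊔_; z≤n; s≤s; _≤?_; _<?_; ⌊_/2⌋; ⌈_/2⌉)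
open import Data.Nat.Properties
open import Data.Nat.Tactic.RingSolver using (solve; solve-∀)
open import Data.List using ([]; _∷_)
open import Data.Product using (_×_; _,_; proj₁; proj₂)
open import Data.Sum using (inj₁; inj₂)
open import Data.Vec using (Vec)
open import Data.Empty using (⊥; ⊥-elim)
open import Relation.Binary.Definitions using (Tri; tri<; tri≈; tri>)
open import Relation.Nullary using (yes; no; ¬_)
open import Relation.Binary.PropositionalEquality
open import Algebra.Properties.CommutativeSemigroup +-commutativeSemigroup using (xy∙z≈xz∙y; x∙yz≈y∙xz)

-- Linear arithmetic: to derive p ≤ q from a ≤ b (typically a sum of hypotheses built with _⊕_),
-- exhibit k with p + b + k ≡ q + a and let the ring solver check that identity.
≤-by : ∀ {a b p q} k → a ≤ b → p + b + k ≡ q + a → p ≤ q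
≤-by {a} {b} {p} {q} k a≤b eq = +-cancelʳ-≤ a p q (begin
  p + a     ≤⟨ +-monoʳ-≤ p a≤b ⟩
  p + b     ≤⟨ m≤m+n (p + b) k ⟩
  p + b + k ≡⟨ eq ⟩
  q + a     ∎)
  where open ≤-Reasoning

≤-by-sum : ∀ {p q} k → p + k ≡ q → p ≤ q
≤-by-sum {p} k refl = m≤m+n p k

≡-by : ∀ {a b p q} → a ≡ b → p + b ≡ q + a → p ≡ q
≡-by {a} {p = p} {q} refl eq = +-cancelʳ-≡ a p q eq

infixl 6 _⊕_

_⊕_ : ∀ {a b c d} → a ≤ b → c ≤ d → a + c ≤ b + d
_⊕_ = +-mono-≤

module Palindromes {X : Set} (s : ℕ → X) (n : ℕ) where

  -- Positions are 0-based and the midpoint c sits between positions c − 1 and c, so x and y are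
  -- mirror images about c exactly when x + y + 1 = 2c.
  Symmetric : ℕ → ℕ → Set
  Symmetric c L = ∀ x y → suc (x + y) ≡ c + c → x < c + L → y < c + L → s x ≡ s y

  record Palindrome (c L : ℕ) : Set where
    constructor palindrome
    field
      radius≤centre : L ≤ c
      ends-within   : c + L ≤ n
      symmetric     : Symmetric c L

  mirror-image : ∀ c {x} → x < c + c → suc x + (c + c ∸ suc x) ≡ c + c
  mirror-image c = m+[n∸m]≡n

  symmetric-from-right : ∀ {c L} → (∀ x y → suc (x + y) ≡ c + c → c ≤ y → y < c + L → s x ≡ s y) →
                         Symmetric c L
  symmetric-from-right {c} right x y e x< y< with c ≤? y | c ≤? x
  ... | yes c≤y | _     = right x y e c≤y y<
  ... | no _    | yes c≤x = sym (right y x (trans (cong suc (+-comm y x)) e) c≤x x<)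
  ... | no c≰y  | no c≰x =
    ⊥-elim (n≮n (c + c) (≤-by 0 (≰⇒> c≰x ⊕ ≰⇒> c≰y ⊕ ≤-reflexive (sym e))
                                (solve (x ∷ y ∷ c ∷ []))))

  palindrome-mono : ∀ {c L k} → k ≤ L → Palindrome c L → Palindrome c k
  palindrome-mono {c} {L} {k} k≤L (palindrome L≤c c+L≤n sym-c) =
    palindrome (≤-trans k≤L L≤c) (≤-trans c+k≤c+L c+L≤n)
      λ x y e x< y< → sym-c x y e (<-≤-trans x< c+k≤c+L) (<-≤-trans y< c+k≤c+L)
    where
    c+k≤c+L : c + k ≤ c + L
    c+k≤c+L = +-monoʳ-≤ c k≤L

  palindrome-reflect : ∀ {c L c₁ k c₂} → Palindrome c L → Palindrome c₁ k → c₁ + c₂ ≡ c + c →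
                       c + k ≤ c₁ + L → c₁ + k ≤ c + L → Palindrome c₂ k
  palindrome-reflect {c} {L} {c₁} {k} {c₂} (palindrome L≤c c+L≤n sym-c) (palindrome _ _ sym-c₁)
                     e c+k≤ c₁+k≤ =
    palindrome k≤c₂ (≤-trans c₂+k≤c+L c+L≤n) symmetric
    where
    k≤c₂ : k ≤ c₂
    k≤c₂ = ≤-by 0 (c₁+k≤ ⊕ L≤c ⊕ ≤-reflexive (sym e)) (solve (c ∷ L ∷ c₁ ∷ k ∷ c₂ ∷ []))
    c₂+k≤c+L : c₂ + k ≤ c + L
    c₂+k≤c+L = ≤-by 0 (c+k≤ ⊕ ≤-reflexive e) (solve (c ∷ L ∷ c₁ ∷ k ∷ c₂ ∷ []))
    symmetric : Symmetric c₂ k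
    symmetric x y exy x< y< =
      via (c + c ∸ suc x) (c + c ∸ suc y) (mirror-image c x<2c) (mirror-image c y<2c)
      where
      c+L≤2c : c + L ≤ c + c
      c+L≤2c = +-monoʳ-≤ c L≤c
      x<2c : x < c + c
      x<2c = <-≤-trans x< (≤-trans c₂+k≤c+L c+L≤2c)
      y<2c : y < c + c
      y<2c = <-≤-trans y< (≤-trans c₂+k≤c+L c+L≤2c)
      via : ∀ x' y' → suc x + x' ≡ c + c → suc y + y' ≡ c + c → s x ≡ s y
      via x' y' ex ey = begin
        s x  ≡⟨ sym-c x x' ex (<-≤-trans x< c₂+k≤c+L) (<-≤-trans x'< c₁+k≤) ⟩
        s x' ≡⟨ sym-c₁ x' y' e' x'< y'< ⟩
        s y' ≡⟨ sym-c y' y (trans (cong suc (+-comm y' y)) ey)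
                         (<-≤-trans y'< c₁+k≤) (<-≤-trans y< c₂+k≤c+L) ⟩
        s y  ∎
        where
        open ≡-Reasoning
        x'< : x' < c₁ + k
        x'< = ≤-by 0 (y< ⊕ ≤-reflexive ex ⊕ ≤-reflexive (sym exy) ⊕ ≤-reflexive (sym e))
                (solve (x ∷ y ∷ x' ∷ c ∷ c₁ ∷ c₂ ∷ k ∷ []))
        y'< : y' < c₁ + k
        y'< = ≤-by 0 (x< ⊕ ≤-reflexive ey ⊕ ≤-reflexive (sym exy) ⊕ ≤-reflexive (sym e))
                (solve (x ∷ y ∷ y' ∷ c ∷ c₁ ∷ c₂ ∷ k ∷ []))
        e' : suc (x' + y') ≡ c₁ + c₁
        e' = ≡-by (cong₂ _+_ (cong₂ _+_ ex ey) (cong₂ _+_ (sym exy) (cong₂ _+_ (sym e) (sym e))))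
               (solve (x ∷ y ∷ x' ∷ y' ∷ c ∷ c₁ ∷ c₂ ∷ []))

  -- The only new pair (c − L − 1, c + L) is linked by reflections about c − t, c and c + t.
  palindrome-extend : ∀ {c L c₋ c₊ t k} → Palindrome c L → Palindrome c₋ k → Palindrome c₊ k →
                      c₋ + t ≡ c → c + t ≡ c₊ → 1 ≤ t → t ≤ L → L < t + k → Palindrome c (suc L)
  palindrome-extend {c₋ = c₋} {t = t} {k}
                    (palindrome _ _ sym-c) (palindrome k≤c₋ _ sym₋) (palindrome _ c₊+k≤n sym₊)
                    refl refl 1≤t t≤L L<t+k
    with m≤n⇒∃[o]m+o≡n t≤L
  ... | j , refl = palindrome (≤-by 0 (j<k ⊕ k≤c₋) (solve (c₋ ∷ t ∷ j ∷ k ∷ [])))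
                              (≤-by 0 (j<k ⊕ c₊+k≤n) (solve (c₋ ∷ t ∷ j ∷ k ∷ n ∷ [])))
                              (symmetric-from-right right)
    where
    j<k : j < k
    j<k = +-cancelˡ-< t j k L<t+k
    right : ∀ x y → suc (x + y) ≡ c₋ + t + (c₋ + t) → c₋ + t ≤ y → y < c₋ + t + suc (t + j) →
            s x ≡ s y
    right x y e c≤y y< with y <? c₋ + t + (t + j)
    ... | yes y<c+L =
      sym-c x y e (≤-by (t + j) (c≤y ⊕ ≤-reflexive e) (solve (x ∷ y ∷ c₋ ∷ t ∷ j ∷ []))) y<c+L
    ... | no y≮c+L
      with ≤-antisym (≤-pred (≤-trans y< (≤-reflexive (+-suc (c₋ + t) (t + j))))) (≮⇒≥ y≮c+L)
    ...   | refl = begin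
      s x                        ≡⟨ sym₋ x (c₋ + j) e₋ x<c₋+k (+-monoʳ-< c₋ j<k) ⟩
      s (c₋ + j)                 ≡⟨ sym-c (c₋ + j) (x + t + t) e₀ c₋+j<c+L x+2t<c+L ⟩
      s (x + t + t)              ≡⟨ sym₊ (x + t + t) (c₋ + t + (t + j)) e₊ x+2t<c₊+k c+L<c₊+k ⟩
      s (c₋ + t + (t + j))       ∎
      where
      open ≡-Reasoning
      e₋ : suc (x + (c₋ + j)) ≡ c₋ + c₋
      e₋ = ≡-by e (solve (x ∷ c₋ ∷ t ∷ j ∷ []))
      e₀ : suc (c₋ + j + (x + t + t)) ≡ c₋ + t + (c₋ + t)
      e₀ = ≡-by e (solve (x ∷ c₋ ∷ t ∷ j ∷ []))
      e₊ : suc (x + t + t + (c₋ + t + (t + j))) ≡ c₋ + t + t + (c₋ + t + t)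
      e₊ = ≡-by e (solve (x ∷ c₋ ∷ t ∷ j ∷ []))
      x<c₋+k : x < c₋ + k
      x<c₋+k = ≤-by (k + j) (≤-reflexive e) (solve (x ∷ c₋ ∷ t ∷ j ∷ k ∷ []))
      c₋+j<c+L : c₋ + j < c₋ + t + (t + j)
      c₋+j<c+L = ≤-by t 1≤t (solve (c₋ ∷ t ∷ j ∷ []))
      x+2t<c+L : x + t + t < c₋ + t + (t + j)
      x+2t<c+L = ≤-by (j + j) (≤-reflexive e) (solve (x ∷ c₋ ∷ t ∷ j ∷ []))
      x+2t<c₊+k : x + t + t < c₋ + t + t + k
      x+2t<c₊+k = ≤-by (j + k) (≤-reflexive e) (solve (x ∷ c₋ ∷ t ∷ j ∷ k ∷ []))
      c+L<c₊+k : c₋ + t + (t + j) < c₋ + t + t + k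
      c+L<c₊+k = ≤-by 0 j<k (solve (c₋ ∷ t ∷ j ∷ k ∷ []))

  record Periodic (p lo hi : ℕ) : Set where
    constructor periodicity
    field
      repeats : ∀ x → lo ≤ x → x + p < hi → s x ≡ s (x + p)
  open Periodic

  -- Reflecting about c and then about c + g translates by 2g.
  palindromes⇒periodic : ∀ {c c' g K lo} → Palindrome c K → Palindrome c' K →
                         lo + K ≡ c → c + g ≡ c' → Periodic (g + g) lo (c' + K)
  palindromes⇒periodic {g = g} {K} {lo} (palindrome _ _ sym-c) (palindrome _ _ sym-c') refl refl =
    periodicity translate
    where
    translate : ∀ x → lo ≤ x → x + (g + g) < lo + K + g + K → s x ≡ s (x + (g + g))
    translate x lo≤x x+2g<hi = via (lo + K + (lo + K) ∸ suc x) (mirror-image (lo + K) x<2c)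
      where
      x<2c : x < lo + K + (lo + K)
      x<2c = ≤-by (lo + g) x+2g<hi (solve (x ∷ g ∷ K ∷ lo ∷ []))
      via : ∀ u → suc x + u ≡ lo + K + (lo + K) → s x ≡ s (x + (g + g))
      via u eu = trans (sym-c x u eu x<c+K u<c+K) (sym-c' u (x + (g + g)) e' u<c'+K x+2g<hi)
        where
        x<c+K : x < lo + K + K
        x<c+K = ≤-by g x+2g<hi (solve (x ∷ g ∷ K ∷ lo ∷ []))
        u<c+K : u < lo + K + K
        u<c+K = ≤-by 0 (lo≤x ⊕ ≤-reflexive eu) (solve (x ∷ u ∷ K ∷ lo ∷ []))
        u<c'+K : u < lo + K + g + K
        u<c'+K = ≤-by g (lo≤x ⊕ ≤-reflexive eu) (solve (x ∷ u ∷ g ∷ K ∷ lo ∷ []))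
        e' : suc (u + (x + (g + g))) ≡ lo + K + g + (lo + K + g)
        e' = ≡-by eu (solve (x ∷ u ∷ g ∷ K ∷ lo ∷ []))

  periodic-extendˡ : ∀ {p q lo hi lo' hi'} → Periodic p lo hi → Periodic q lo' hi' →
                     lo' ≤ lo + p → lo' + p + q ≤ hi → lo' + p + q ≤ hi' → Periodic q lo hi'
  periodic-extendˡ {p} {q} {lo} {hi} {lo'} {hi'} (periodicity per) (periodicity per') lo'≤ ≤hi ≤hi' =
    periodicity extended
    where
    extended : ∀ x → lo ≤ x → x + q < hi' → s x ≡ s (x + q)
    extended x lo≤x x+q<hi' with lo' ≤? x
    ... | yes lo'≤x = per' x lo'≤x x+q<hi'
    ... | no lo'≰x = begin
      s x           ≡⟨ per x lo≤x (≤-by q (x<lo' ⊕ ≤hi) (solve (x ∷ p ∷ q ∷ lo' ∷ hi ∷ []))) ⟩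
      s (x + p)     ≡⟨ per' (x + p) (≤-trans lo'≤ (+-monoˡ-≤ p lo≤x))
                                    (≤-by 0 (x<lo' ⊕ ≤hi') (solve (x ∷ p ∷ q ∷ lo' ∷ hi' ∷ []))) ⟩
      s (x + p + q) ≡⟨ cong s (xy∙z≈xz∙y x p q) ⟩
      s (x + q + p) ≡⟨ sym (per (x + q) (≤-trans lo≤x (m≤m+n x q))
                                        (≤-by 0 (x<lo' ⊕ ≤hi) (solve (x ∷ p ∷ q ∷ lo' ∷ hi ∷ [])))) ⟩
      s (x + q)     ∎
      where
      open ≡-Reasoning
      x<lo' : x < lo'
      x<lo' = ≰⇒> lo'≰x

  periodic-extendʳ : ∀ {p q lo hi lo' hi'} → Periodic p lo hi → Periodic q lo' hi' →
                     lo' + p + q ≤ hi → lo + p + q ≤ hi → hi' ≤ hi + q → Periodic p lo hi'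
  periodic-extendʳ {p} {q} {lo} {hi} {lo'} {hi'} (periodicity per) (periodicity per') ≤hi ≤hi' hi'≤ =
    periodicity extended
    where
    extended : ∀ x → lo ≤ x → x + p < hi' → s x ≡ s (x + p)
    extended x lo≤x x+p<hi' with x + p <? hi
    ... | yes x+p<hi = per x lo≤x x+p<hi
    ... | no x+p≮hi = via (x ∸ q) (m∸n+n≡m q≤x)
      where
      hi≤x+p : hi ≤ x + p
      hi≤x+p = ≮⇒≥ x+p≮hi
      q≤x : q ≤ x
      q≤x = ≤-by lo (hi≤x+p ⊕ ≤hi') (solve (x ∷ p ∷ q ∷ lo ∷ hi ∷ []))
      via : ∀ y → y + q ≡ x → s x ≡ s (x + p)
      via y refl = begin
        s (y + q)     ≡⟨ sym (per' y lo'≤y (≤-by p x+p<hi' (solve (y ∷ p ∷ q ∷ hi' ∷ [])))) ⟩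
        s y           ≡⟨ per y lo≤y (≤-by 0 (x+p<hi' ⊕ hi'≤) (solve (y ∷ p ∷ q ∷ hi ∷ hi' ∷ []))) ⟩
        s (y + p)     ≡⟨ per' (y + p) (≤-trans lo'≤y (m≤m+n y p))
                                      (≤-by 0 x+p<hi' (solve (y ∷ p ∷ q ∷ hi' ∷ []))) ⟩
        s (y + p + q) ≡⟨ cong s (xy∙z≈xz∙y y p q) ⟩
        s (y + q + p) ∎
        where
        open ≡-Reasoning
        lo'≤y : lo' ≤ y
        lo'≤y = ≤-by 0 (hi≤x+p ⊕ ≤hi) (solve (y ∷ p ∷ q ∷ lo' ∷ hi ∷ []))
        lo≤y : lo ≤ y
        lo≤y = ≤-by 0 (hi≤x+p ⊕ ≤hi') (solve (y ∷ p ∷ q ∷ lo ∷ hi ∷ []))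

  palindrome-shiftˡ : ∀ {c g K lo hi} → Palindrome (c + g) K → Periodic (g + g) lo hi →
                      lo + K ≤ c → c + g + g ≤ hi → g ≤ K → Palindrome c K
  palindrome-shiftˡ {c} {g} {K} {lo} {hi} (palindrome _ c+g+K≤n sym-c) per lo+K≤c c+2g≤hi g≤K =
    palindrome (≤-trans (m≤n+m K lo) lo+K≤c) (≤-trans (+-monoˡ-≤ K (m≤m+n c g)) c+g+K≤n)
               (symmetric-from-right right)
    where
    right : ∀ x y → suc (x + y) ≡ c + c → c ≤ y → y < c + K → s x ≡ s y
    right x y e c≤y y< = begin
      s x             ≡⟨ repeats per x lo≤x (≤-by 0 (x<c ⊕ c+2g≤hi) (solve (x ∷ c ∷ g ∷ hi ∷ []))) ⟩
      s (x + (g + g)) ≡⟨ sym-c (x + (g + g)) y (≡-by e (solve (x ∷ y ∷ c ∷ g ∷ [])))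
                               (≤-by 0 (x<c ⊕ g≤K) (solve (x ∷ c ∷ g ∷ K ∷ [])))
                               (≤-by g y< (solve (y ∷ c ∷ g ∷ K ∷ []))) ⟩
      s y             ∎
      where
      open ≡-Reasoning
      x<c : x < c
      x<c = ≤-by 0 (c≤y ⊕ ≤-reflexive e) (solve (x ∷ y ∷ c ∷ []))
      lo≤x : lo ≤ x
      lo≤x = ≤-by 0 (y< ⊕ ≤-reflexive (sym e) ⊕ lo+K≤c) (solve (x ∷ y ∷ c ∷ K ∷ lo ∷ []))

  palindrome-shiftʳ : ∀ {c g K lo hi} → Palindrome c K → Periodic (g + g) lo hi →
                      lo + K ≤ c → c + g + K ≤ hi → g ≤ K → c + g + K ≤ n → Palindrome (c + g) K
  palindrome-shiftʳ {c} {g} {K} {lo} (palindrome K≤c _ sym-c) per lo+K≤c c+g+K≤hi g≤K c+g+K≤n =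
    palindrome (≤-trans K≤c (m≤m+n c g)) c+g+K≤n (symmetric-from-right right)
    where
    right : ∀ x y → suc (x + y) ≡ c + g + (c + g) → c + g ≤ y → y < c + g + K → s x ≡ s y
    right x y e c+g≤y y< = via (y ∸ (g + g)) (m∸n+n≡m 2g≤y)
      where
      2g≤y : g + g ≤ y
      2g≤y = ≤-by lo (c+g≤y ⊕ lo+K≤c ⊕ g≤K) (solve (y ∷ c ∷ g ∷ K ∷ lo ∷ []))
      via : ∀ z → z + (g + g) ≡ y → s x ≡ s y
      via z ez = begin
        s x             ≡⟨ sym-c x z (≡-by (cong₂ _+_ e ez) (solve (x ∷ y ∷ z ∷ c ∷ g ∷ [])))
                                 (≤-by 0 (c+g≤y ⊕ ≤-reflexive e ⊕ g≤K)
                                         (solve (x ∷ y ∷ c ∷ g ∷ K ∷ [])))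
                                 (≤-by g (y< ⊕ ≤-reflexive ez) (solve (y ∷ z ∷ c ∷ g ∷ K ∷ []))) ⟩
        s z             ≡⟨ repeats per z (≤-by 0 (c+g≤y ⊕ lo+K≤c ⊕ g≤K ⊕ ≤-reflexive (sym ez))
                                                 (solve (y ∷ z ∷ c ∷ g ∷ K ∷ lo ∷ [])))
                               (≤-trans (≤-trans (≤-reflexive (cong suc ez)) y<) c+g+K≤hi) ⟩
        s (z + (g + g)) ≡⟨ cong s ez ⟩
        s y             ∎
        where open ≡-Reasoning

  -- With unequal gaps, the period of the narrower gap extends over the window of the wider one,
  -- and shifting the middle palindrome by the narrower gap gives the mirror image of its nearer
  -- neighbour.
  mirror-of-right : ∀ {a d g K} → Palindrome a K → Palindrome (a + d + g) K →
                    Palindrome (a + d + g + g) K → (d + g) + (d + g) ≤ K → Palindrome (a + d) K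
  mirror-of-right {d = d} {g} {K} Pa@(palindrome K≤a _ _) Pp Pq 2[d+g]≤K with m≤n⇒∃[o]m+o≡n K≤a
  ... | lo , refl = palindrome-shiftˡ {c = K + lo + d} {g} Pp period-g
                      (≤-by-sum d (solve (d ∷ K ∷ lo ∷ []))) (≤-by-sum K (solve (d ∷ g ∷ K ∷ lo ∷ []))) g≤K
    where
    g≤K : g ≤ K
    g≤K = ≤-by (d + d + g) 2[d+g]≤K (solve (d ∷ g ∷ K ∷ []))
    period-d+g : Periodic ((d + g) + (d + g)) lo (K + lo + d + g + K)
    period-d+g = palindromes⇒periodic {g = d + g} Pa Pp (+-comm lo K) (sym (+-assoc (K + lo) d g))
    period-g : Periodic (g + g) lo (K + lo + d + g + g + K)
    period-g = periodic-extendˡ period-d+g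
                 (palindromes⇒periodic {g = g} {lo = lo + d + g} Pp Pq (solve (d ∷ g ∷ K ∷ lo ∷ [])) refl)
                 (≤-by-sum (d + g) (solve (d ∷ g ∷ lo ∷ [])))
                 (≤-by (d + d) (2[d+g]≤K ⊕ 2[d+g]≤K) (solve (d ∷ g ∷ K ∷ lo ∷ [])))
                 (≤-by (d + d + g) (2[d+g]≤K ⊕ 2[d+g]≤K) (solve (d ∷ g ∷ K ∷ lo ∷ [])))

  mirror-of-left : ∀ {a g d K} → Palindrome a K → Palindrome (a + g) K →
                   Palindrome (a + g + g + d) K → (g + d) + (g + d) ≤ K → Palindrome (a + g + g) K
  mirror-of-left {g = g} {d} {K} Pa@(palindrome K≤a _ _) Pp Pq@(palindrome _ q+K≤n _) 2[g+d]≤K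
    with m≤n⇒∃[o]m+o≡n K≤a
  ... | lo , refl = palindrome-shiftʳ {c = K + lo + g} {g} Pp period-g
                      (≤-by-sum g (solve (g ∷ K ∷ lo ∷ []))) (≤-by-sum d (solve (g ∷ d ∷ K ∷ lo ∷ []))) g≤K
                      (≤-trans (+-monoˡ-≤ K (m≤m+n (K + lo + g + g) d)) q+K≤n)
    where
    g≤K : g ≤ K
    g≤K = ≤-by (g + d + d) 2[g+d]≤K (solve (g ∷ d ∷ K ∷ []))
    period-g : Periodic (g + g) lo (K + lo + g + g + d + K)
    period-g = periodic-extendʳ (palindromes⇒periodic {g = g} Pa Pp (+-comm lo K) refl)
                 (palindromes⇒periodic {g = g + d} {lo = lo + g} Pp Pq
                                       (solve (g ∷ K ∷ lo ∷ [])) (solve (g ∷ d ∷ K ∷ lo ∷ [])))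
                 (≤-by (d + d) (2[g+d]≤K ⊕ 2[g+d]≤K) (solve (g ∷ d ∷ K ∷ lo ∷ [])))
                 (≤-by (g + d + d) (2[g+d]≤K ⊕ 2[g+d]≤K) (solve (g ∷ d ∷ K ∷ lo ∷ [])))
                 (≤-by-sum (g + d) (solve (g ∷ d ∷ K ∷ lo ∷ [])))

  equal-gaps : ∀ {a g₁ g₂ K} → Palindrome a K → Palindrome (a + g₁) K → Palindrome (a + g₁ + g₂) K →
               1 ≤ g₁ → 1 ≤ g₂ → g₁ + g₁ ≤ K → g₂ + g₂ ≤ K →
               (∀ c → a < c → c < a + g₁ → ¬ Palindrome c K) →
               (∀ c → a + g₁ < c → c < a + g₁ + g₂ → ¬ Palindrome c K) → g₁ ≡ g₂
  equal-gaps {a} {g₁} {g₂} {K} Pa Pp Pq 1≤g₁ 1≤g₂ 2g₁≤K 2g₂≤K none-before none-after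
    with <-cmp g₁ g₂
  ... | tri≈ _ g₁≡g₂ _ = g₁≡g₂
  ... | tri< g₁<g₂ _ _ with m≤n⇒∃[o]m+o≡n g₁<g₂
  ...   | d , refl = ⊥-elim (none-after (a + g₁ + g₁) (m<m+n (a + g₁) 1≤g₁)
                              (≤-by-sum d (solve (a ∷ g₁ ∷ d ∷ [])))
                              (mirror-of-left Pa Pp (subst (λ c → Palindrome c K) (rearrange a g₁ d) Pq)
                                              (≤-by 0 2g₂≤K (solve (g₁ ∷ d ∷ K ∷ [])))))
    where
    rearrange : ∀ a g d → a + g + suc (g + d) ≡ a + g + g + suc d
    rearrange = solve-∀
  equal-gaps {a} {g₁} {g₂} {K} Pa Pp Pq _ 1≤g₂ 2g₁≤K _ none-before _ | tri> _ _ g₂<g₁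
    with m≤n⇒∃[o]m+o≡n g₂<g₁
  ... | d , refl = ⊥-elim (none-before (a + suc d) (m<m+n a (s≤s z≤n))
                            (≤-by 0 1≤g₂ (solve (a ∷ g₂ ∷ d ∷ [])))
                            (mirror-of-right Pa (subst (λ c → Palindrome c K) (rearrange₁ a g₂ d) Pp)
                                                (subst (λ c → Palindrome c K) (rearrange₂ a g₂ d) Pq)
                                                (≤-by 0 2g₁≤K (solve (g₂ ∷ d ∷ K ∷ [])))))
    where
    rearrange₁ : ∀ a g d → a + suc (g + d) ≡ a + suc d + g
    rearrange₁ = solve-∀
    rearrange₂ : ∀ a g d → a + suc (g + d) + g ≡ a + suc d + g + g
    rearrange₂ = solve-∀

record Tent (Δ a L b : ℕ) : Set where
  field
    rises : a < b → Δ + a ≡ L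
    falls : b < a → Δ + b ≡ L
    above : ∀ k → k ≤ a → k ≤ b → Δ + k ≤ L

tent-swap : ∀ {Δ a L b} → Tent Δ a L b → Tent Δ b L a
tent-swap T = record { rises = falls ; falls = rises ; above = λ k k≤b k≤a → above k k≤a k≤b }
  where open Tent T

tent-descends : ∀ {Δ a L b} → 1 ≤ Δ → Tent Δ a L b → L ≤ a → Δ + b ≡ L
tent-descends {Δ} {a} {L} {b} 1≤Δ T L≤a = by-cases (<-cmp a b)
  where
  open Tent T
  not-above : Δ + a ≤ L → ⊥
  not-above Δ+a≤L = n≮n a (≤-trans (+-monoˡ-≤ a 1≤Δ) (≤-trans Δ+a≤L L≤a))
  by-cases : Tri (a < b) (a ≡ b) (b < a) → Δ + b ≡ L
  by-cases (tri< a<b _ _) = ⊥-elim (not-above (≤-reflexive (rises a<b)))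
  by-cases (tri≈ _ a≡b _) = ⊥-elim (not-above (above a ≤-refl (≤-reflexive a≡b)))
  by-cases (tri> _ _ b<a) = falls b<a

tent-bounded : ∀ {Δ a L b} → Tent Δ a L b → b ≤ L → b ≤ Δ + a
tent-bounded {Δ} {a} {L} {b} T b≤L with b ≤? a
... | yes b≤a = ≤-trans b≤a (m≤n+m a Δ)
... | no b≰a = subst (b ≤_) (sym (Tent.rises T (≰⇒> b≰a))) b≤L

-- ℓ at the midpoints 1 … h of a maximal run and at the points 0 and h + 1 one gap beyond its ends.
record Profile (len : ℕ → ℕ) (h K Δ : ℕ) : Set where
  field
    Δ-positive : 1 ≤ Δ
    left-end   : len 0 < K
    right-end  : len (suc h) < K
    interior   : ∀ i → 1 ≤ i → i ≤ h → K ≤ len i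
    tent       : ∀ i → suc i ≤ h → Tent Δ (len i) (len (suc i)) (len (suc (suc i)))

reverse-profile : ∀ {len rev h K Δ} → Profile len h K Δ → (∀ i j → i + j ≡ suc h → rev i ≡ len j) →
                  Profile rev h K Δ
reverse-profile {len} {rev} {h} {K} {Δ} P rev≡ = record
  { Δ-positive = Δ-positive
  ; left-end   = subst (_< K) (sym (rev≡ 0 (suc h) refl)) right-end
  ; right-end  = subst (_< K) (sym (rev≡ (suc h) 0 (+-identityʳ (suc h)))) left-end
  ; interior   = interior′
  ; tent       = tent′
  }
  where
  open Profile P
  interior′ : ∀ i → 1 ≤ i → i ≤ h → K ≤ rev i
  interior′ i 1≤i i≤h with m≤n⇒∃[o]m+o≡n (m≤n⇒m≤1+n i≤h)
  ... | j , i+j = subst (K ≤_) (sym (rev≡ i j i+j))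
                    (interior j (≤-by 0 (i≤h ⊕ ≤-reflexive (sym i+j)) (solve (i ∷ j ∷ h ∷ [])))
                                (≤-by 0 (1≤i ⊕ ≤-reflexive i+j) (solve (i ∷ j ∷ h ∷ []))))
  tent′ : ∀ i → suc i ≤ h → Tent Δ (rev i) (rev (suc i)) (rev (suc (suc i)))
  tent′ i i<h with m≤n⇒∃[o]m+o≡n i<h
  ... | r , refl
    rewrite rev≡ i (suc (suc r)) (solve (i ∷ r ∷ []))
          | rev≡ (suc i) (suc r) (solve (i ∷ r ∷ []))
          | rev≡ (suc (suc i)) r (solve (i ∷ r ∷ []))
    = tent-swap (tent r (≤-by-sum i (solve (i ∷ r ∷ []))))

descent : ∀ {len h K Δ} → Profile len h K Δ → ∀ t i → t + suc i ≡ h → len (suc i) ≤ len i →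
          len (suc i) ≡ len (suc h) + suc t * Δ
descent {len} {Δ = Δ} P zero i refl fall = begin
  len (suc i)                   ≡⟨ sym (tent-descends Δ-positive (tent i ≤-refl) fall) ⟩
  Δ + len (suc (suc i))         ≡⟨ trans (+-comm Δ _) (cong (len (suc (suc i)) +_) (sym (*-identityˡ Δ))) ⟩
  len (suc (suc i)) + 1 * Δ     ∎
  where
  open Profile P
  open ≡-Reasoning
descent {len} {h} {Δ = Δ} P (suc t) i e fall = begin
  len (suc i)                         ≡⟨ sym step ⟩
  Δ + len (suc (suc i))               ≡⟨ cong (Δ +_) (descent P t (suc i) (trans (+-suc t (suc i)) e) fall′) ⟩
  Δ + (len (suc h) + suc t * Δ)       ≡⟨ x∙yz≈y∙xz Δ (len (suc h)) (suc t * Δ) ⟩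
  len (suc h) + suc (suc t) * Δ       ∎
  where
  open Profile P
  open ≡-Reasoning
  step : Δ + len (suc (suc i)) ≡ len (suc i)
  step = tent-descends Δ-positive (tent i (≤-by (suc t) (≤-reflexive e) (solve (t ∷ i ∷ h ∷ [])))) fall
  fall′ : len (suc (suc i)) ≤ len (suc i)
  fall′ = subst (len (suc (suc i)) ≤_) step (m≤n+m _ Δ)

right-edge : ∀ {len h K Δ} → Profile len h K Δ → 2 ≤ h → Δ + len (suc h) ≡ len h
right-edge {h = suc zero} P (s≤s ())
right-edge {h = suc (suc h)} P _ =
  Tent.falls (tent (suc h) ≤-refl) (<-≤-trans right-end (interior (suc h) (s≤s z≤n) (n≤1+n (suc h))))
  where open Profile P

ascending : ∀ {len h K Δ} → Profile len h K Δ → ∀ j → j + j < h →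
            len j < len (suc j) × len j ≤ len 0 + j * Δ
ascending {len} P zero 0<h = <-≤-trans left-end (interior 1 ≤-refl 0<h) , m≤m+n (len 0) 0
  where open Profile P
ascending {len} {h} {K} {Δ} P (suc j) 2j+2<h = rise , bound
  where
  open Profile P
  previous : len j < len (suc j) × len j ≤ len 0 + j * Δ
  previous = ascending P j (≤-by 2 2j+2<h (solve (j ∷ h ∷ [])))
  j+2≤h : suc (suc j) ≤ h
  j+2≤h = ≤-by (suc j) 2j+2<h (solve (j ∷ h ∷ []))
  T : Tent Δ (len j) (len (suc j)) (len (suc (suc j)))
  T = tent j (≤-trans (n≤1+n (suc j)) j+2≤h)
  -- A descent at j + 1 would reach len (suc h) after too few steps of size Δ for the ascent from len 0.
  no-early-descent : ∀ {X Y Z W H} t → Y ≡ X + suc t * Δ → Y ≤ Δ + Z → Z ≤ W + j * Δ →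
                     W < K → K ≤ H → H ≡ Δ + X → suc (suc j) * Δ ≤ suc t * Δ → ⊥
  no-early-descent {X} {Y} {Z} {W} {H} t e₁ e₂ e₃ e₄ e₅ e₆ e₇ =
    n≮n 0 (≤-by 0 (≤-reflexive (sym e₁) ⊕ e₂ ⊕ e₃ ⊕ e₄ ⊕ e₅ ⊕ ≤-reflexive e₆ ⊕ e₇)
                  (solve (X ∷ Y ∷ Z ∷ W ∷ H ∷ K ∷ Δ ∷ j ∷ t ∷ [])))
  descent-from : ∀ t → t + suc (suc j) ≡ h → len (suc (suc j)) ≤ len (suc j) → ⊥
  descent-from t e fall =
    no-early-descent t (descent P t (suc j) e fall) (tent-bounded T fall) (proj₂ previous) left-end
      (interior h (≤-trans (s≤s z≤n) 2j+2<h) ≤-refl) (sym (right-edge P (≤-trans (s≤s (s≤s z≤n)) 2j+2<h)))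
      (*-monoˡ-≤ Δ (s≤s j<t))
    where
    j<t : j < t
    j<t = ≤-by 0 (2j+2<h ⊕ ≤-reflexive (sym e)) (solve (j ∷ t ∷ h ∷ []))
  rise : len (suc j) < len (suc (suc j))
  rise with len (suc (suc j)) ≤? len (suc j)
  ... | no no-fall = ≰⇒> no-fall
  ... | yes fall = ⊥-elim (descent-from (h ∸ suc (suc j)) (m∸n+n≡m j+2≤h) fall)
  bound : len (suc j) ≤ len 0 + suc j * Δ
  bound = begin
    len (suc j)             ≡⟨ sym (Tent.rises T (<-trans (proj₁ previous) rise)) ⟩
    Δ + len j               ≤⟨ +-monoʳ-≤ Δ (proj₂ previous) ⟩
    Δ + (len 0 + j * Δ)     ≡⟨ x∙yz≈y∙xz Δ (len 0) (j * Δ) ⟩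
    len 0 + suc j * Δ       ∎
    where open ≤-Reasoning

increasing-to : ∀ {len : ℕ → ℕ} {f} → (∀ i → i < f → len i < len (suc i)) →
                ∀ {j} → j < f → len j < len f
increasing-to {f = suc f} step {j} j<1+f with m≤n⇒m<n∨m≡n (≤-pred j<1+f)
... | inj₁ j<f  = <-trans (increasing-to (λ i i<f → step i (m<n⇒m<1+n i<f)) j<f) (step f ≤-refl)
... | inj₂ refl = step j ≤-refl

peak-left : ∀ {len h K Δ f c} → Profile len h K Δ → f ≤ c → f + c ≡ suc h →
            ∀ {j} → j < f → len j < len f
peak-left {len} {h} {f = f} {c} P f≤c f+c j<f = increasing-to {len} {f} rises j<f
  where
  rises : ∀ i → i < f → len i < len (suc i)
  rises i i<f =
    proj₁ (ascending P i (≤-by 0 (i<f ⊕ i<f ⊕ f≤c ⊕ ≤-reflexive f+c) (solve (i ∷ f ∷ c ∷ h ∷ []))))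

peak : ∀ {len h K Δ f c} → Profile len h K Δ → f ≤ c → c ≤ suc f → f + c ≡ suc h →
       ∀ {j} → j ≤ h → j ≢ f → j ≢ c → len j < len f ⊔ len c
peak {len} {h} {f = f} {c} P f≤c c≤1+f f+c {j} j≤h j≢f j≢c with j <? f
... | yes j<f = <-≤-trans (peak-left P f≤c f+c j<f) (m≤m⊔n (len f) (len c))
... | no j≮f = <-≤-trans (mirrored (suc h ∸ j) (m∸n+n≡m (m≤n⇒m≤1+n j≤h))) (m≤n⊔m (len f) (len c))
  where
  c<j : c < j
  c<j = ≤∧≢⇒< (≤-trans c≤1+f (≤∧≢⇒< (≮⇒≥ j≮f) (≢-sym j≢f))) (≢-sym j≢c)
  rev≡ : ∀ i k → i + k ≡ suc h → len (suc h ∸ i) ≡ len k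
  rev≡ i k e = cong len (trans (cong (_∸ i) (sym e)) (m+n∸m≡n i k))
  mirrored : ∀ j' → j' + j ≡ suc h → len j < len c
  mirrored j' e =
    subst₂ _<_ (rev≡ j' j e) (rev≡ f c f+c) (peak-left (reverse-profile P rev≡) f≤c f+c {j'} j'<f)
    where
    j'<f : j' < f
    j'<f = ≤-by 0 (c<j ⊕ ≤-reflexive e ⊕ ≤-reflexive (sym f+c)) (solve (j ∷ j' ∷ f ∷ c ∷ h ∷ []))

peak-at-halves : ∀ {len h K Δ} → Profile len h K Δ →
                 ∀ {j} → j ≤ h → j ≢ ⌊ suc h /2⌋ → j ≢ ⌈ suc h /2⌉ →
                 len j < len ⌊ suc h /2⌋ ⊔ len ⌈ suc h /2⌉
peak-at-halves {h = h} P =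
  peak P (⌊n/2⌋≤⌈n/2⌉ (suc h)) (s≤s (⌊n/2⌋-mono (n≤1+n h))) (⌊n/2⌋+⌈n/2⌉≡n (suc h))

halves-within : ∀ {h} → 1 ≤ h → 1 ≤ ⌊ suc h /2⌋ × ⌈ suc h /2⌉ ≤ h
halves-within {suc h} _ = s≤s z≤n , ≤-pred (⌈n/2⌉<n h)

module MaximalPalindromes {A : Set} {n : ℕ} (S : Vec A n) (ℓ : ℕ → ℕ) (ℓ-spec : IsPalLenFun S ℓ) where
  open Palindromes (at S) n public

  Pal⇒palindrome : ∀ {c L} → Pal S c L → Palindrome c L
  Pal⇒palindrome {c} {L} (L≤c , c+L≤n , pal) = palindrome L≤c c+L≤n (symmetric-from-right right)
    where
    right : ∀ x y → suc (x + y) ≡ c + c → c ≤ y → y < c + L → at S x ≡ at S y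
    right x y e c≤y y< with m≤n⇒∃[o]m+o≡n c≤y
    ... | j , refl = begin
      at S x               ≡⟨ cong (at S) (trans (sym (m+n∸n≡m x (suc j))) (cong (_∸ suc j) x+1+j≡c)) ⟩
      at S (c ∸ suc j)     ≡⟨ pal (suc j) (s≤s z≤n) (≤-by 0 y< (solve (c ∷ j ∷ L ∷ []))) ⟩
      at S (c + suc j ∸ 1) ≡⟨ cong (λ z → at S (z ∸ 1)) (+-suc c j) ⟩
      at S (c + j)         ∎
      where
      open ≡-Reasoning
      x+1+j≡c : x + suc j ≡ c
      x+1+j≡c = ≡-by e (solve (x ∷ c ∷ j ∷ []))

  palindrome⇒Pal : ∀ {c L} → Palindrome c L → Pal S c L
  palindrome⇒Pal {c} {L} (palindrome L≤c c+L≤n sym-c) = L≤c , c+L≤n , pal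
    where
    pal : ∀ i → 1 ≤ i → i ≤ L → at S (c ∸ i) ≡ at S (c + i ∸ 1)
    pal (suc j) _ i≤L = via (c ∸ suc j) (m∸n+n≡m (≤-trans i≤L L≤c))
      where
      via : ∀ x → x + suc j ≡ c → at S x ≡ at S (c + suc j ∸ 1)
      via x ex = trans (sym-c x (c + j) (≡-by ex (solve (x ∷ c ∷ j ∷ [])))
                                        (≤-by (L + j) (≤-reflexive ex) (solve (x ∷ c ∷ j ∷ L ∷ [])))
                                        (+-monoʳ-< c i≤L))
                       (cong (λ z → at S (z ∸ 1)) (sym (+-suc c j)))

  palindrome-ℓ : ∀ {c} → 1 ≤ c → c ≤ n → Palindrome c (ℓ c)
  palindrome-ℓ {c} 1≤c c≤n = Pal⇒palindrome (proj₁ (proj₁ (ℓ-spec c) 1≤c c≤n))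

  ℓ-maximal : ∀ {c L} → Palindrome c L → L ≤ ℓ c
  ℓ-maximal {L = zero} _ = z≤n
  ℓ-maximal {c} {suc L} P@(palindrome 1+L≤c c+1+L≤n _) =
    proj₂ (proj₁ (ℓ-spec c) (≤-trans (s≤s z≤n) 1+L≤c) (≤-trans (m≤m+n c (suc L)) c+1+L≤n))
          (suc L) (palindrome⇒Pal P)

  centre-in-range : ∀ {c} → 1 ≤ ℓ c → 1 ≤ c × c ≤ n
  centre-in-range {zero} 1≤ℓ =
    ⊥-elim (n≮n 0 (≤-trans 1≤ℓ (≤-reflexive (proj₁ (proj₂ (ℓ-spec 0)) refl))))
  centre-in-range {suc c} 1≤ℓ with suc c ≤? n
  ... | yes c<n = s≤s z≤n , c<n
  ... | no c≮n =
    ⊥-elim (n≮n 0 (≤-trans 1≤ℓ (≤-reflexive (proj₂ (proj₂ (ℓ-spec (suc c))) (≰⇒> c≮n)))))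

  palindrome-≤ℓ : ∀ {c k} → 1 ≤ k → k ≤ ℓ c → Palindrome c k
  palindrome-≤ℓ 1≤k k≤ℓ with centre-in-range (≤-trans 1≤k k≤ℓ)
  ... | 1≤c , c≤n = palindrome-mono k≤ℓ (palindrome-ℓ 1≤c c≤n)

  tent-at : ∀ {c₋ Δ} → 1 ≤ Δ → Δ ≤ ℓ (c₋ + Δ) → Tent Δ (ℓ c₋) (ℓ (c₋ + Δ)) (ℓ (c₋ + Δ + Δ))
  tent-at {c₋} {Δ} 1≤Δ Δ≤L = record { rises = rises ; falls = falls ; above = above }
    where
    L a b : ℕ
    L = ℓ (c₋ + Δ)
    a = ℓ c₋
    b = ℓ (c₋ + Δ + Δ)
    centre : Palindrome (c₋ + Δ) L
    centre = palindrome-≤ℓ (≤-trans 1≤Δ Δ≤L) ≤-refl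
    shifted : ∀ x {k M} → Δ + k ≤ M → x + Δ + k ≤ x + M
    shifted x {k} {M} Δ+k≤M = subst (_≤ x + M) (sym (+-assoc x Δ k)) (+-monoʳ-≤ x Δ+k≤M)
    to-left : ∀ k → 1 ≤ k → k ≤ b → Δ + k ≤ L → k ≤ a
    to-left k 1≤k k≤b Δ+k≤L =
      ℓ-maximal (palindrome-reflect {c₁ = c₋ + Δ + Δ} {c₂ = c₋} centre (palindrome-≤ℓ 1≤k k≤b)
                  (solve (c₋ ∷ Δ ∷ []))
                  (+-mono-≤ (m≤m+n (c₋ + Δ) Δ) (m+n≤o⇒n≤o Δ Δ+k≤L)) (shifted (c₋ + Δ) Δ+k≤L))
    to-right : ∀ k → 1 ≤ k → k ≤ a → Δ + k ≤ L → k ≤ b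
    to-right k 1≤k k≤a Δ+k≤L =
      ℓ-maximal (palindrome-reflect {c₁ = c₋} {c₂ = c₋ + Δ + Δ} centre (palindrome-≤ℓ 1≤k k≤a)
                  (solve (c₋ ∷ Δ ∷ []))
                  (shifted c₋ Δ+k≤L) (+-mono-≤ (m≤m+n c₋ Δ) (m+n≤o⇒n≤o Δ Δ+k≤L)))
    above : ∀ k → k ≤ a → k ≤ b → Δ + k ≤ L
    above zero _ _ = subst (_≤ L) (sym (+-identityʳ Δ)) Δ≤L
    above (suc k) k≤a k≤b with Δ + suc k ≤? L
    ... | yes Δ+k≤L = Δ+k≤L
    ... | no Δ+k≰L =
      ⊥-elim (n≮n L (ℓ-maximal (palindrome-extend centre (palindrome-≤ℓ (s≤s z≤n) k≤a)
                                  (palindrome-≤ℓ (s≤s z≤n) k≤b) refl refl 1≤Δ Δ≤L (≰⇒> Δ+k≰L))))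
    rises : a < b → Δ + a ≡ L
    rises a<b = ≤-antisym (above a ≤-refl (<⇒≤ a<b))
      (≮⇒≥ λ Δ+a<L → n≮n a (to-left (suc a) (s≤s z≤n) a<b (≤-trans (≤-reflexive (+-suc Δ a)) Δ+a<L)))
    falls : b < a → Δ + b ≡ L
    falls b<a = ≤-antisym (above b (<⇒≤ b<a) ≤-refl)
      (≮⇒≥ λ Δ+b<L → n≮n b (to-right (suc b) (s≤s z≤n) b<a (≤-trans (≤-reflexive (+-suc Δ b)) Δ+b<L)))

  module Run (K h : ℕ) (m : ℕ → ℕ) where

    Δ : ℕ
    Δ = m 2 ∸ m 1

    position : ℕ → ℕ
    position zero    = m 1 ∸ Δ
    position (suc i) = position i + Δ

    Δ-positive : IsMaximalRun S ℓ K h m → 1 ≤ Δ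
    Δ-positive (3≤h , _ , increasing , _) = m<n⇒0<n∸m (increasing 1 ≤-refl (≤-trans (n≤1+n 2) 3≤h))

    Δ+Δ≤K : IsMaximalRun S ℓ K h m → Δ + Δ ≤ K
    Δ+Δ≤K (3≤h , _ , _ , _ , gaps , _) =
      subst (_≤ K) (cong (Δ +_) (+-identityʳ Δ)) (gaps 1 ≤-refl (≤-trans (n≤1+n 2) 3≤h))

    Δ≤K : IsMaximalRun S ℓ K h m → Δ ≤ K
    Δ≤K run = ≤-trans (m≤m+n Δ Δ) (Δ+Δ≤K run)

    midpoint-palindrome : IsMaximalRun S ℓ K h m → ∀ i → 1 ≤ i → i ≤ h → Palindrome (m i) K
    midpoint-palindrome run@(_ , midpoints , _) i 1≤i i≤h =
      palindrome-≤ℓ (≤-trans (Δ-positive run) (Δ≤K run)) (proj₂ (proj₂ (midpoints i 1≤i i≤h)))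

    no-palindrome-between : IsMaximalRun S ℓ K h m → ∀ j → 1 ≤ j → j < h →
                            ∀ c → m j < c → c < m (suc j) → ¬ Palindrome c K
    no-palindrome-between (_ , _ , _ , consecutive , _) j 1≤j j<h c mj<c c<mj+1 P =
      <⇒≱ (consecutive j 1≤j j<h c mj<c c<mj+1) (ℓ-maximal P)

    gaps-equal : IsMaximalRun S ℓ K h m → ∀ j → 1 ≤ j → j < h → m (suc j) ≡ m j + Δ
    gaps-equal run@(_ , _ , increasing , _ , gaps , _) = go
      where
      go : ∀ j → 1 ≤ j → j < h → m (suc j) ≡ m j + Δ
      go (suc zero) _ 1<h = sym (m+[n∸m]≡n (<⇒≤ (increasing 1 ≤-refl 1<h)))
      go (suc (suc j)) _ j+2<h = next (go (suc j) (s≤s z≤n) j+1<h)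
        where
        a p q g : ℕ
        a = m (suc j)
        p = m (suc (suc j))
        q = m (suc (suc (suc j)))
        g = q ∸ p
        j+1<h : suc j < h
        j+1<h = ≤-trans (n≤1+n _) j+2<h
        p<q : p < q
        p<q = increasing (suc (suc j)) (s≤s z≤n) j+2<h
        p+g≡q : p + g ≡ q
        p+g≡q = m+[n∸m]≡n (<⇒≤ p<q)
        next : p ≡ a + Δ → q ≡ p + Δ
        next p≡a+Δ = trans (sym p+g≡q) (cong (p +_) (sym Δ≡g))
          where
          a+Δ+g≡q : a + Δ + g ≡ q
          a+Δ+g≡q = trans (cong (_+ g) (sym p≡a+Δ)) p+g≡q
          palindrome-at : ∀ {c} i → c ≡ m i → 1 ≤ i → i ≤ h → Palindrome c K
          palindrome-at i refl 1≤i i≤h = midpoint-palindrome run i 1≤i i≤h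
          Δ≡g : Δ ≡ g
          Δ≡g = equal-gaps (palindrome-at (suc j) refl (s≤s z≤n) (<⇒≤ j+1<h))
                  (palindrome-at (suc (suc j)) (sym p≡a+Δ) (s≤s z≤n) (<⇒≤ j+2<h))
                  (palindrome-at (suc (suc (suc j))) a+Δ+g≡q (s≤s z≤n) j+2<h)
                  (Δ-positive run) (m<n⇒0<n∸m p<q) (Δ+Δ≤K run)
                  (subst (_≤ K) (cong (g +_) (+-identityʳ g)) (gaps (suc (suc j)) (s≤s z≤n) j+2<h))
                  (λ c a<c c<a+Δ → no-palindrome-between run (suc j) (s≤s z≤n) j+1<h c a<c
                                     (subst (c <_) (sym p≡a+Δ) c<a+Δ))
                  (λ c a+Δ<c c<q → no-palindrome-between run (suc (suc j)) (s≤s z≤n) j+2<h c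
                                     (subst (_< c) (sym p≡a+Δ) a+Δ<c) (subst (c <_) a+Δ+g≡q c<q))

    position-midpoint : IsMaximalRun S ℓ K h m → ∀ i → 1 ≤ i → i ≤ h → position i ≡ m i
    position-midpoint run (suc zero) _ 1≤h =
      m∸n+n≡m (≤-trans (Δ≤K run) (Palindrome.radius≤centre (midpoint-palindrome run 1 ≤-refl 1≤h)))
    position-midpoint run (suc (suc i)) _ i+2≤h =
      trans (cong (_+ Δ) (position-midpoint run (suc i) (s≤s z≤n) (≤-trans (n≤1+n _) i+2≤h)))
            (sym (gaps-equal run (suc i) (s≤s z≤n) i+2≤h))

    run-profile : IsMaximalRun S ℓ K h m → Profile (λ i → ℓ (position i)) h K Δ
    run-profile run@(3≤h , midpoints , _ , _ , _ , left-maximal , right-maximal) = record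
      { Δ-positive = Δ-positive run
      ; left-end   = left-maximal
      ; right-end  = subst (λ c → ℓ (c + Δ) < K) (sym (position-midpoint run h 1≤h ≤-refl)) right-maximal
      ; interior   = interior
      ; tent       = λ i i<h → tent-at (Δ-positive run) (≤-trans (Δ≤K run) (interior (suc i) (s≤s z≤n) i<h))
      }
      where
      1≤h : 1 ≤ h
      1≤h = ≤-trans (s≤s z≤n) 3≤h
      interior : ∀ i → 1 ≤ i → i ≤ h → K ≤ ℓ (position i)
      interior i 1≤i i≤h =
        subst (λ c → K ≤ ℓ c) (sym (position-midpoint run i 1≤i i≤h))
              (proj₂ (proj₂ (midpoints i 1≤i i≤h)))

lemma8 : {A : Set} {n : ℕ} (S : Vec A n) (ℓ : ℕ → ℕ) → IsPalLenFun S ℓ →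
         (ℓ* h : ℕ) (m : ℕ → ℕ) → IsMaximalRun S ℓ ℓ* h m →
         ∀ j → 1 ≤ j → j ≤ h → j ≢ ⌊ suc h /2⌋ → j ≢ ⌈ suc h /2⌉ →
         ℓ (m j) < ℓ (m ⌊ suc h /2⌋) ⊔ ℓ (m ⌈ suc h /2⌉)
lemma8 S ℓ ℓ-spec ℓ* h m run@(3≤h , _) j 1≤j j≤h j≢f j≢c =
  subst₂ _<_ (at-midpoint j 1≤j j≤h)
             (cong₂ _⊔_ (at-midpoint _ 1≤f (≤-trans f≤c c≤h)) (at-midpoint _ (≤-trans 1≤f f≤c) c≤h))
             (peak-at-halves (run-profile run) j≤h j≢f j≢c)
  where
  open MaximalPalindromes S ℓ ℓ-spec
  open Run ℓ* h m
  1≤f : 1 ≤ ⌊ suc h /2⌋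
  1≤f = proj₁ (halves-within (≤-trans (s≤s z≤n) 3≤h))
  c≤h : ⌈ suc h /2⌉ ≤ h
  c≤h = proj₂ (halves-within (≤-trans (s≤s z≤n) 3≤h))
  f≤c : ⌊ suc h /2⌋ ≤ ⌈ suc h /2⌉
  f≤c = ⌊n/2⌋≤⌈n/2⌉ (suc h)
  at-midpoint : ∀ i → 1 ≤ i → i ≤ h → ℓ (position i) ≡ ℓ (m i)
  at-midpoint i 1≤i i≤h = cong ℓ (position-midpoint run i 1≤i i≤h)
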